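{- Let $G$ be a finite graph (loopless, possibly with multiple edges). Then $\check{s}(G)\le 3$ if and only if there exists a decomposition of $G$ into at most four Class 1 regular subgraphs $H_0,H_1,H_2,H_3$ (any of which may be absent from the decomposition) with the following properties: - $H_0$, if present, is spanning; - there exists a partition of $V(G)$ into at most three subsets $A_1,A_2,A_3$ (some of which may be empty) such that $V(H_1)=A_2\cup A_3$ (if $H_1$ is present), $V(H_2)=A_1\cup A_3$ (if $H_2$ is present), and either $V(H_3)=A_3$ or $V(H_3)=A_1\cup A_2$ (if $H_3$ is present).
   Context: A $k$-edge-coloring of $G$ is a map $c\colon E(G)\to\{1,\dots,k\}$ such that any two distinct edges sharing an endpoint receive different colors. The palette of a vertex $v$ with respect to $c$ is $P_c(v)=\{c(e): e \text{ incident with } v\}$ (empty if $v$ is isolated). The palette index $\check{s}(G)$ is the minimum, over all edge-colorings $c$ of $G$ (with any number of colors), of the number of distinct palettes $P_c(v)$, $v\in V(G)$. A graph with maximum degree $\Delta$ is Class 1 if it admits a $\Delta$-edge-coloring; so an $r$-regular graph is Class 1 iff it admits an $r$-edge-coloring. A decomposition of $G$ is a family $\{H_i\}$ of subgraphs of $G$, each with nonempty edge set, whose edge sets are pairwise disjoint and have union $E(G)$. A subgraph is spanning if its vertex set is $V(G)$. -}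

module Defs where

open import Data.Nat using (ℕ)
open import Data.Fin using (Fin; _≟_)
open import Data.Fin.Subset using (Subset; _∈_)
open import Data.List using (length; filter; allFin)
open import Data.Fin.Patterns using (0F; 1F; 2F; 3F)
open import Data.Product using (Σ; ∃; _×_; _,_; proj₁; proj₂)
open import Data.Sum using (_⊎_)
open import Function.Bundles using (_⇔_)
open import Relation.Nullary using (¬_)
open import Relation.Nullary.Decidable using (_×-dec_; _⊎-dec_)
open import Relation.Binary.PropositionalEquality using (_≡_; _≢_)

record Multigraph : Set where
  field
    n     : ℕ
    m     : ℕ
    ends  : Fin m → Fin n × Fin n
    loopless : ∀ e → proj₁ (ends e) ≢ proj₂ (ends e)

module _ (G : Multigraph) where
  open Multigraph G

  Incident : Fin m → Fin n → Set
  Incident e v = (proj₁ (ends e) ≡ v) ⊎ (proj₂ (ends e) ≡ v)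

  Adjacent : Fin m → Fin m → Set
  Adjacent e e' = e ≢ e' × ∃ λ v → Incident e v × Incident e' v

  ProperColoring : {k : ℕ} → (Fin m → Fin k) → Set
  ProperColoring c = ∀ e e' → Adjacent e e' → c e ≢ c e'

  InPalette : {k : ℕ} → (Fin m → Fin k) → Fin n → Fin k → Set
  InPalette c v i = ∃ λ e → Incident e v × c e ≡ i

  SamePalette : {k : ℕ} → (Fin m → Fin k) → Fin n → Fin n → Set
  SamePalette c v w = ∀ i → InPalette c v i ⇔ InPalette c w i

  AtMostPalettes : {k : ℕ} → (Fin m → Fin k) → ℕ → Set
  AtMostPalettes c t = ∃ λ (f : Fin n → Fin t) → ∀ v w → f v ≡ f w → SamePalette c v w

  PaletteIndex≤ : ℕ → Set
  PaletteIndex≤ t = ∃ λ (k : ℕ) → ∃ λ (c : Fin m → Fin k) → ProperColoring c × AtMostPalettes c t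

  -- Subgraphs given by an edge-assignment a : Fin m → Fin 4 (edge e belongs
  -- to H_(a e)) and vertex sets V : Fin 4 → Subset n.

  degIn : (a : Fin m → Fin 4) → Fin 4 → Fin n → ℕ
  degIn a i v = length (filter (λ e → (a e ≟ i) ×-dec ((proj₁ (ends e) ≟ v) ⊎-dec (proj₂ (ends e) ≟ v))) (allFin m))

  Present : (a : Fin m → Fin 4) → Fin 4 → Set
  Present a i = ∃ λ e → a e ≡ i

  IsSubgraph : (a : Fin m → Fin 4) → (V : Fin 4 → Subset n) → Fin 4 → Set
  IsSubgraph a V i = ∀ e → a e ≡ i → (proj₁ (ends e) ∈ V i) × (proj₂ (ends e) ∈ V i)

  IsRegularOf : (a : Fin m → Fin 4) → (V : Fin 4 → Subset n) → Fin 4 → ℕ → Set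
  IsRegularOf a V i r = ∀ v → v ∈ V i → degIn a i v ≡ r

  HasEdgeColoringOf : (a : Fin m → Fin 4) → Fin 4 → ℕ → Set
  HasEdgeColoringOf a i r = ∃ λ (c : Fin m → Fin r) →
    ∀ e e' → a e ≡ i → a e' ≡ i → Adjacent e e' → c e ≢ c e'

  Class1Regular : (a : Fin m → Fin 4) → (V : Fin 4 → Subset n) → Fin 4 → Set
  Class1Regular a V i = IsSubgraph a V i × (∃ λ r → IsRegularOf a V i r × HasEdgeColoringOf a i r)

  -- the decomposition condition of the theorem (indices 0,1,2,3 = H_0..H_3;
  -- partition p : A_1 = p⁻¹(0), A_2 = p⁻¹(1), A_3 = p⁻¹(2))
  GoodDecomposition : Set
  GoodDecomposition =
    ∃ λ (a : Fin m → Fin 4) → ∃ λ (V : Fin 4 → Subset n) →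
      (∀ i → Present a i → Class1Regular a V i) ×
      (Present a 0F → ∀ v → v ∈ V 0F) ×
      (∃ λ (p : Fin n → Fin 3) →
        (Present a 1F → ∀ v → (v ∈ V 1F) ⇔ (p v ≡ 1F ⊎ p v ≡ 2F)) ×
        (Present a 2F → ∀ v → (v ∈ V 2F) ⇔ (p v ≡ 0F ⊎ p v ≡ 2F)) ×
        (Present a 3F → (∀ v → (v ∈ V 3F) ⇔ (p v ≡ 2F))
                      ⊎ (∀ v → (v ∈ V 3F) ⇔ (p v ≡ 0F ⊎ p v ≡ 1F))))

{-# OPTIONS --safe #-}
-- Backward: colour each Hᵢ properly with its own rᵢ colours, tagged with i. A proper rᵢ-colouring
-- of an rᵢ-regular graph shows every colour at every vertex, so the palette of v is the set of
-- tagged colours of those Hᵢ that contain v, and that set depends only on the part containing v.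
--
-- Forward: let f send each vertex to one of its three palettes. A colour x is seen by exactly the
-- vertices whose class lies in a set τ x ⊆ {0,1,2}, and its edges form a perfect matching of them.
-- Two colours of disjoint types together form a matching of the union of their types, so they can
-- be merged into one colour. Merging as much as possible colours of types {i} and {j}, and of types
-- {j} and ∁{j}, leaves for each j colours of type {j} or of type ∁{j} but not both, and colours
-- of singleton type for at most one j. The merged colours of type ⊤ then form H₀, those of type {j}
-- or ∁{j} one of H₁, H₂, H₃ (the possible singleton type going to H₃), each of them regular and
-- properly coloured by its merged colours.

module Submission where

open import Level using (0ℓ)
open import Data.Bool using (true; if_then_else_)
import Data.Bool.Properties as Bool
open import Data.Fin using (Fin; zero; suc; _≟_; punchOut; toℕ; fromℕ<; combine)
open import Data.Fin.Patterns using (0F; 1F; 2F; 3F)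
open import Data.Fin.Permutation using (Permutation; transpose; _⟨$⟩ʳ_; _⟨$⟩ˡ_; inverseˡ; inverseʳ)
open import Data.Fin.Properties
  using (any?; injective⇒≤; punchOut-injective; toℕ<n; toℕ-injective; toℕ-fromℕ<; fromℕ<-cong; combine-injective)
open import Data.Fin.Subset using (Subset; Nonempty; _⊆_; _∪_; ⁅_⁆; ∁; ⊤; inside; outside)
  renaming (_∈_ to _∈ˢ_; _∉_ to _∉ˢ_)
open import Data.Fin.Subset.Properties
  using (_∈?_; p⊆p∪q; q⊆p∪q; x∈p∪q⁻; x∈⁅x⁆; x∈⁅y⁆⇒x≡y; x∈⁅y⁆⇔x≡y; x∈∁p⇒x∉p; x∉p⇒x∈∁p; p∪∁p≡⊤;
         ∈⊤; ∉⊥)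
open import Data.List using (List; _∷_; length; filter; allFin; lookup)
import Data.List.Relation.Unary.All as All
open import Data.List.Relation.Unary.All.Properties using (all-filter)
open import Data.List.Relation.Unary.AllPairs using (_∷_)
open import Data.List.Relation.Unary.Any using (index)
open import Data.List.Relation.Unary.Any.Properties using (lookup-index)
open import Data.List.Relation.Unary.Unique.Propositional using (Unique)
open import Data.List.Relation.Unary.Unique.Propositional.Properties using (allFin⁺; filter⁺)
open import Data.List.Membership.Propositional.Properties using (∈-allFin; ∈-filter⁺; ∈-lookup)
open import Data.Nat using (ℕ; zero; suc; _≤_; _<_; _*_; NonZero; >-nonZero) renaming (_≟_ to _≟ℕ_)
open import Data.Nat.DivMod using (_mod_; m<n⇒m%n≡m)
open import Data.Nat.Properties
  using (≤-antisym; <-irrefl; <-≤-trans; n<1+n; m<n⇒m<1+n; m<1+n⇒m≤n; ≤∧≢⇒<; m<n⇒0<n; m<n⇒n≢0)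
open import Data.Product using (∃; _×_; _,_; proj₁; proj₂)
import Data.Product.Properties as Product
open import Data.Sum using (_⊎_; inj₁; inj₂)
import Data.Sum as Sum
open import Data.Vec using ([]; _∷_; here; there; tabulate)
open import Data.Vec.Properties using (≡-dec; []=⇒lookup; lookup⇒[]=; lookup∘tabulate)
open import Function using (_∘_)
open import Function.Bundles using (_⇔_; mk⇔; Equivalence)
import Function.Properties.Equivalence as ⇔
open import Relation.Binary.Definitions using (DecidableEquality)
open import Relation.Binary.PropositionalEquality using (_≡_; _≢_; refl; sym; trans; cong; cong₂; subst)
open import Relation.Nullary using (¬_; yes; no; does; contradiction)
open import Relation.Nullary.Decidable
  using (Dec; _×-dec_; _⊎-dec_; dec-true; dec-false; False; toWitnessFalse)
open import Relation.Unary using (Pred; Decidable)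

open import Defs

-- Enumerating a decidable subset of Fin m

lookup-injective : ∀ {A : Set} {xs : List A} → Unique xs →
                   ∀ {i j} → lookup xs i ≡ lookup xs j → i ≡ j
lookup-injective {xs = _ ∷ xs} (_ ∷ _)  {zero}  {zero}  _  = refl
lookup-injective {xs = _ ∷ xs} (x∉ ∷ _) {zero}  {suc j} eq = contradiction eq (All.lookup x∉ (∈-lookup {xs = xs} j))
lookup-injective {xs = _ ∷ xs} (x∉ ∷ _) {suc i} {zero}  eq =
  contradiction (sym eq) (All.lookup x∉ (∈-lookup {xs = xs} i))
lookup-injective {xs = _ ∷ _}  (_ ∷ u)  {suc i} {suc j} eq = cong suc (lookup-injective u eq)

module Enumeration {m : ℕ} {P : Pred (Fin m) 0ℓ} (P? : Decidable P) where

  members : List (Fin m)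
  members = filter P? (allFin m)

  nth : Fin (length members) → Fin m
  nth = lookup members

  nth-satisfies : ∀ i → P (nth i)
  nth-satisfies i = All.lookup (all-filter P? (allFin m)) (∈-lookup i)

  nth-injective : ∀ {i j} → nth i ≡ nth j → i ≡ j
  nth-injective = lookup-injective (filter⁺ P? (allFin⁺ m))

  position : ∀ {e} → P e → Fin (length members)
  position p = index (∈-filter⁺ P? (∈-allFin _) p)

  nth-position : ∀ {e} (p : P e) → nth (position p) ≡ e
  nth-position p = sym (lookup-index (∈-filter⁺ P? (∈-allFin _) p))

  length≤ : length members ≤ m
  length≤ = injective⇒≤ nth-injective

  injectiveOn⇒length≤ : ∀ {r} (h : Fin m → Fin r) →
                        (∀ {e e′} → P e → P e′ → h e ≡ h e′ → e ≡ e′) → length members ≤ r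
  injectiveOn⇒length≤ h inj =
    injective⇒≤ (λ eq → nth-injective (inj (nth-satisfies _) (nth-satisfies _) eq))

  injection⇒≤length : ∀ {r} (g : Fin r → Fin m) → (∀ s → P (g s)) →
                      (∀ {s s′} → g s ≡ g s′ → s ≡ s′) → r ≤ length members
  injection⇒≤length g Pg inj = injective⇒≤ {f = λ s → position (Pg s)}
    (λ {s} {s′} eq → inj (trans (sym (nth-position (Pg s))) (trans (cong nth eq) (nth-position (Pg s′)))))

  injectiveOn⇒surjective : ∀ {r} (h : Fin m → Fin r) →
                           (∀ {e e′} → P e → P e′ → h e ≡ h e′ → e ≡ e′) →
                           length members ≡ r → ∀ s → ∃ λ e → P e × h e ≡ s
  injectiveOn⇒surjective {suc r} h inj length≡ s with any? (λ i → h (nth i) ≟ s)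
  ... | yes (i , hit) = nth i , nth-satisfies i , hit
  ... | no missed = contradiction (subst (_≤ r) length≡ (injective⇒≤ avoiding-s-injective)) (<-irrefl refl)
    where
    avoiding-s : Fin (length members) → Fin r
    avoiding-s i = punchOut {i = s} (λ eq → missed (i , sym eq))
    avoiding-s-injective : ∀ {i j} → avoiding-s i ≡ avoiding-s j → i ≡ j
    avoiding-s-injective {i} {j} eq = nth-injective (inj (nth-satisfies i) (nth-satisfies j)
      (punchOut-injective {i = s} (λ eq → missed (i , sym eq)) (λ eq → missed (j , sym eq)) eq))

module _ (G : Multigraph) where
  open Multigraph G

  incident? : ∀ e v → Dec (Incident G e v)
  incident? e v = (proj₁ (ends e) ≟ v) ⊎-dec (proj₂ (ends e) ≟ v)

  endpoint∈ : ∀ {e v} {U : Subset n} → Incident G e v →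
              proj₁ (ends e) ∈ˢ U × proj₂ (ends e) ∈ˢ U → v ∈ˢ U
  endpoint∈ (inj₁ refl) (u∈U , _) = u∈U
  endpoint∈ (inj₂ refl) (_ , w∈U) = w∈U

  module _ (a : Fin m → Fin 4) (i : Fin 4) where

    EdgeOfAt : Fin n → Fin m → Set
    EdgeOfAt v e = a e ≡ i × Incident G e v

    edgeOfAt? : ∀ v e → Dec (EdgeOfAt v e)
    edgeOfAt? v e = (a e ≟ i) ×-dec incident? e v

    ProperOn : ∀ {r} → (Fin m → Fin r) → Set
    ProperOn c = ∀ e e′ → a e ≡ i → a e′ ≡ i → Adjacent G e e′ → c e ≢ c e′

    module _ {r} {c : Fin m → Fin r} (proper : ProperOn c) where

      properOn⇒injectiveAt : ∀ v {e e′} → EdgeOfAt v e → EdgeOfAt v e′ → c e ≡ c e′ → e ≡ e′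
      properOn⇒injectiveAt v {e} {e′} (ae , e∋v) (ae′ , e′∋v) ce≡ce′ with e ≟ e′
      ... | yes e≡e′ = e≡e′
      ... | no e≢e′ = contradiction ce≡ce′ (proper e e′ ae ae′ (e≢e′ , v , e∋v , e′∋v))

      regular⇒everyColourAt : ∀ {V} → IsRegularOf G a V i r → ∀ {v} → v ∈ˢ V i →
                               ∀ s → ∃ λ e → EdgeOfAt v e × c e ≡ s
      regular⇒everyColourAt regular {v} v∈V =
        Enumeration.injectiveOn⇒surjective (edgeOfAt? v) c (properOn⇒injectiveAt v) (regular v v∈V)

    degIn≤ : ∀ v → degIn G a i v ≤ m
    degIn≤ v = Enumeration.length≤ (edgeOfAt? v)

  -- Decompositions give at most three palettes

  module FromDecomposition (a : Fin m → Fin 4) (V : Fin 4 → Subset n)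
                           (class1 : ∀ i → Present G a i → Class1Regular G a V i) where

    -- A canonical choice, so that all edges of Hᵢ are coloured by the same colouring of Hᵢ.
    chosen : ∀ i → Present G a i → Class1Regular G a V i
    chosen i pr with any? (λ e → a e ≟ i)
    ... | yes pr′ = class1 i pr′
    ... | no ¬pr = contradiction pr ¬pr

    chosen-irrelevant : ∀ i (pr pr′ : Present G a i) → chosen i pr ≡ chosen i pr′
    chosen-irrelevant i pr _ with any? (λ e → a e ≟ i)
    ... | yes _ = refl
    ... | no ¬pr = contradiction pr ¬pr

    colourIn : ∀ {i} → Class1Regular G a V i → Fin m → ℕ
    colourIn (_ , _ , _ , c , _) e = toℕ (c e)

    colourIn<m : ∀ {i e} (H : Class1Regular G a V i) → a e ≡ i → colourIn H e < m
    colourIn<m {i} {e} (subgraph , r , regular , c , _) ae =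
      <-≤-trans (toℕ<n (c e)) (subst (_≤ m) (regular _ (proj₁ (subgraph e ae))) (degIn≤ a i _))

    colourIn-proper : ∀ {i e e′} (H : Class1Regular G a V i) → a e ≡ i → a e′ ≡ i →
                      Adjacent G e e′ → colourIn H e ≢ colourIn H e′
    colourIn-proper (_ , _ , _ , c , proper) ae ae′ adj eq = proper _ _ ae ae′ adj (toℕ-injective eq)

    colourIn-everywhere : ∀ {i e w} (H : Class1Regular G a V i) → a e ≡ i → w ∈ˢ V i →
                          ∃ λ e′ → EdgeOfAt a i w e′ × colourIn H e′ ≡ colourIn H e
    colourIn-everywhere {i} {e} (_ , _ , regular , c , proper) _ w∈V
      with e′ , at , ce′≡ce ← regular⇒everyColourAt a i proper {V = V} regular w∈V (c e)
      = e′ , at , cong toℕ ce′≡ce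

    localColour : Fin m → ℕ
    localColour e = colourIn (chosen (a e) (e , refl)) e

    localColour≡colourIn : ∀ {i e} (pr : Present G a i) → a e ≡ i →
                           localColour e ≡ colourIn (chosen i pr) e
    localColour≡colourIn {e = e} pr refl = cong (λ H → colourIn H e) (chosen-irrelevant _ (e , refl) pr)

    localColour<m : ∀ e → localColour e < m
    localColour<m e = colourIn<m (chosen (a e) (e , refl)) refl

    colouring : Fin m → Fin (4 * m)
    colouring e = combine (a e) (fromℕ< (localColour<m e))

    colouring-injective : ∀ {e e′} → colouring e ≡ colouring e′ →
                          a e ≡ a e′ × localColour e ≡ localColour e′
    colouring-injective {e} {e′} eq with ae≡ae′ , local≡ ← combine-injective _ _ _ _ eq =
      ae≡ae′ ,
      trans (sym (toℕ-fromℕ< (localColour<m e))) (trans (cong toℕ local≡) (toℕ-fromℕ< (localColour<m e′)))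

    colouring-cong : ∀ {e e′} → a e ≡ a e′ → localColour e ≡ localColour e′ → colouring e ≡ colouring e′
    colouring-cong {e} {e′} ae≡ae′ local≡ =
      cong₂ combine ae≡ae′ (fromℕ<-cong _ _ local≡ (localColour<m e) (localColour<m e′))

    colouring-proper : ProperColoring G colouring
    colouring-proper e e′ adj eq with ae≡ae′ , local≡ ← colouring-injective eq =
      colourIn-proper (chosen (a e′) pr) ae≡ae′ refl adj
        (trans (sym (localColour≡colourIn pr ae≡ae′)) (trans local≡ (localColour≡colourIn pr refl)))
      where
      pr : Present G a (a e′)
      pr = e′ , refl

    localColour-everywhere : ∀ {e w} → w ∈ˢ V (a e) →
                             ∃ λ e′ → Incident G e′ w × a e′ ≡ a e × localColour e′ ≡ localColour e
    localColour-everywhere {e} w∈V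
      with e′ , (ae′ , e′∋w) , same ← colourIn-everywhere (chosen (a e) (e , refl)) refl w∈V
      = e′ , e′∋w , ae′ , trans (localColour≡colourIn (e , refl) ae′) same

    incident⇒∈V : ∀ {e v} → Incident G e v → v ∈ˢ V (a e)
    incident⇒∈V {e} e∋v = endpoint∈ e∋v (proj₁ (chosen (a e) (e , refl)) e refl)

    palette-transfer : ∀ {v w} → (∀ i → Present G a i → v ∈ˢ V i → w ∈ˢ V i) →
                       ∀ t → InPalette G colouring v t → InPalette G colouring w t
    palette-transfer V-transfer t (e , e∋v , ce≡t)
      with e′ , e′∋w , ae′ , same ← localColour-everywhere (V-transfer (a e) (e , refl) (incident⇒∈V e∋v))
      = e′ , e′∋w , trans (colouring-cong ae′ same) ce≡t

∈-determinedBy : ∀ {n} {A : Set} {U : Subset n} {p : Fin n → A} (Q : A → Set) →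
                 (∀ v → (v ∈ˢ U) ⇔ Q (p v)) → ∀ {v w} → p v ≡ p w → v ∈ˢ U → w ∈ˢ U
∈-determinedBy Q U≡p⁻¹Q {v} {w} pv≡pw v∈U =
  Equivalence.from (U≡p⁻¹Q w) (subst Q pv≡pw (Equivalence.to (U≡p⁻¹Q v) v∈U))

decomposition⇒paletteIndex≤3 : ∀ G → GoodDecomposition G → PaletteIndex≤ G 3
decomposition⇒paletteIndex≤3 G (a , V , class1 , V₀ , p , V₁ , V₂ , V₃) =
  _ , colouring , colouring-proper , p ,
  λ v w pv≡pw t → mk⇔ (palette-transfer (transfer pv≡pw) t) (palette-transfer (transfer (sym pv≡pw)) t)
  where
  open FromDecomposition G a V class1
  transfer : ∀ {v w} → p v ≡ p w → ∀ i → Present G a i → v ∈ˢ V i → w ∈ˢ V i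
  transfer _  0F pr _ = V₀ pr _
  transfer eq 1F pr = ∈-determinedBy (λ x → x ≡ 1F ⊎ x ≡ 2F) (V₁ pr) eq
  transfer eq 2F pr = ∈-determinedBy (λ x → x ≡ 0F ⊎ x ≡ 2F) (V₂ pr) eq
  transfer eq 3F pr with V₃ pr
  ... | inj₁ V₃≡A₃  = ∈-determinedBy (_≡ 2F) V₃≡A₃ eq
  ... | inj₂ V₃≡A₁₂ = ∈-determinedBy (λ x → x ≡ 0F ⊎ x ≡ 1F) V₃≡A₁₂ eq

-- Merging colours of disjoint types

module _ {A B : Set} (_≟ᴬ_ : DecidableEquality A) where

  -- Opaque, so that case splits on _≟ᴬ_ elsewhere do not reach inside update.
  opaque
    update : (A → B) → A → B → A → B
    update f x y z = if does (z ≟ᴬ x) then y else f z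

    update-same : ∀ f x (y : B) → update f x y x ≡ y
    update-same f x y rewrite dec-true (x ≟ᴬ x) refl = refl

    update-other : ∀ f {x} (y : B) {z} → z ≢ x → update f x y z ≡ f z
    update-other f {x} y {z} z≢x rewrite dec-false (z ≟ᴬ x) z≢x = refl

_≟ˢ_ : ∀ {d} → DecidableEquality (Subset d)
_≟ˢ_ = ≡-dec Bool._≟_

Disjoint : ∀ {d} → Subset d → Subset d → Set
Disjoint A B = ∀ {j} → j ∈ˢ A → j ∉ˢ B

⁅⁆-nonempty : ∀ {d} (i : Fin d) → Nonempty ⁅ i ⁆
⁅⁆-nonempty i = i , x∈⁅x⁆ i

⁅⁆-disjoint : ∀ {d} {i j : Fin d} → i ≢ j → Disjoint ⁅ i ⁆ ⁅ j ⁆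
⁅⁆-disjoint i≢j x∈⁅i⁆ x∈⁅j⁆ =
  i≢j (trans (sym (x∈⁅y⁆⇒x≡y _ x∈⁅i⁆)) (x∈⁅y⁆⇒x≡y _ x∈⁅j⁆))

⁅⁆-∁-disjoint : ∀ {d} {i : Fin d} → Disjoint ⁅ i ⁆ (∁ ⁅ i ⁆)
⁅⁆-∁-disjoint x∈⁅i⁆ x∈∁⁅i⁆ = x∈∁p⇒x∉p x∈∁⁅i⁆ x∈⁅i⁆

module Merge {k d : ℕ} (τ : Fin k → Subset d) where

  Slot : Set
  Slot = Subset d × ℕ

  _≟ₛ_ : DecidableEquality Slot
  _≟ₛ_ = Product.≡-dec _≟ˢ_ _≟ℕ_

  -- The merged colour (T , i) consists of, for each j ∈ T, exactly one colour x with j ∈ τ x.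
  record Merging : Set where
    field
      size    : Subset d → ℕ
      slot    : Fin k → Slot
      type⊆   : ∀ x → τ x ⊆ proj₁ (slot x)
      slot<   : ∀ x {j} → j ∈ˢ τ x → proj₂ (slot x) < size (proj₁ (slot x))
      covered : ∀ {T i j} → i < size T → j ∈ˢ T → ∃ λ x → j ∈ˢ τ x × slot x ≡ (T , i)
      unique  : ∀ {x y j} → j ∈ˢ τ x → j ∈ˢ τ y → slot x ≡ slot y → x ≡ y

  open Merging public

  module OfType (T : Subset d) = Enumeration (λ x → τ x ≟ˢ T)

  rank : ∀ {x T} → τ x ≡ T → ℕ
  rank {T = T} τx≡T = toℕ (OfType.position T τx≡T)

  rank-transport : ∀ {x T} (τx≡T : τ x ≡ T) → (τ x , rank {x} refl) ≡ (T , rank τx≡T)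
  rank-transport refl = refl

  separate : Merging
  separate = record
    { size    = λ T → length (OfType.members T)
    ; slot    = λ x → τ x , rank {x} refl
    ; type⊆   = λ _ j∈τx → j∈τx
    ; slot<   = λ x _ → toℕ<n (OfType.position (τ x) refl)
    ; covered = covered′
    ; unique  = unique′
    }
    where
    covered′ : ∀ {T i j} → i < length (OfType.members T) → j ∈ˢ T →
               ∃ λ x → j ∈ˢ τ x × (τ x , rank {x} refl) ≡ (T , i)
    covered′ {T} {i} i<size j∈T =
      x , subst (_ ∈ˢ_) (sym τx≡T) j∈T ,
      trans (rank-transport τx≡T)
            (cong (T ,_) (trans (cong toℕ (nth-injective (nth-position τx≡T))) (toℕ-fromℕ< i<size)))
      where
      open OfType T
      x : Fin k
      x = nth (fromℕ< i<size)
      τx≡T : τ x ≡ T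
      τx≡T = nth-satisfies (fromℕ< i<size)
    unique′ : ∀ {x y j} → j ∈ˢ τ x → j ∈ˢ τ y → (τ x , rank {x} refl) ≡ (τ y , rank {y} refl) → x ≡ y
    unique′ {x} {y} _ _ eq =
      trans (sym (nth-position refl)) (trans (cong nth (toℕ-injective ranks≡)) (nth-position τy≡τx))
      where
      open OfType (τ x)
      τy≡τx : τ y ≡ τ x
      τy≡τx = sym (cong proj₁ eq)
      ranks≡ : rank {x} refl ≡ rank τy≡τx
      ranks≡ = trans (cong proj₂ eq) (cong proj₂ (rank-transport τy≡τx))

  module MergeTop (S : Merging) {A B : Subset d} (A∩B≡∅ : Disjoint A B)
                  (A≢B : A ≢ B) (A≢C : A ≢ A ∪ B) (B≢C : B ≢ A ∪ B)
                  {a b : ℕ} (sizeA : size S A ≡ suc a) (sizeB : size S B ≡ suc b) where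

    C : Subset d
    C = A ∪ B

    Top : Slot → Set
    Top s = s ≡ (A , a) ⊎ s ≡ (B , b)

    top? : ∀ s → Dec (Top s)
    top? s = (s ≟ₛ (A , a)) ⊎-dec (s ≟ₛ (B , b))

    new : Slot
    new = C , size S C

    opaque
      move : Slot → Slot
      move s with top? s
      ... | yes _ = new
      ... | no _  = s

      move-top : ∀ {s} → Top s → move s ≡ new
      move-top {s} top with top? s
      ... | yes _ = refl
      ... | no ¬top = contradiction top ¬top

      move-rest : ∀ {s} → ¬ Top s → move s ≡ s
      move-rest {s} ¬top with top? s
      ... | yes top = contradiction top ¬top
      ... | no _ = refl

    Top⇒⊆C : ∀ {s} → Top s → proj₁ s ⊆ C
    Top⇒⊆C (inj₁ refl) = p⊆p∪q B
    Top⇒⊆C (inj₂ refl) = q⊆p∪q A B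

    ¬Top : ∀ {T i} → T ≢ A → T ≢ B → ¬ Top (T , i)
    ¬Top T≢A _ (inj₁ eq) = T≢A (cong proj₁ eq)
    ¬Top _ T≢B (inj₂ eq) = T≢B (cong proj₁ eq)

    size′ : Subset d → ℕ
    size′ = update _≟ˢ_ (update _≟ˢ_ (update _≟ˢ_ (size S) A a) B b) C (suc (size S C))

    size′-C : size′ C ≡ suc (size S C)
    size′-C = update-same _≟ˢ_ _ C _

    size′-B : size′ B ≡ b
    size′-B = trans (update-other _≟ˢ_ _ _ B≢C) (update-same _≟ˢ_ _ B b)

    size′-A : size′ A ≡ a
    size′-A = trans (update-other _≟ˢ_ _ _ A≢C) (trans (update-other _≟ˢ_ _ _ A≢B) (update-same _≟ˢ_ _ A a))

    size′-rest : ∀ {T} → T ≢ A → T ≢ B → T ≢ C → size′ T ≡ size S T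
    size′-rest T≢A T≢B T≢C =
      trans (update-other _≟ˢ_ _ _ T≢C) (trans (update-other _≟ˢ_ _ _ T≢B) (update-other _≟ˢ_ _ _ T≢A))

    below-top : ∀ {i n} → i < suc n → i ≢ n → i < n
    below-top i<1+n i≢n = ≤∧≢⇒< (m<1+n⇒m≤n i<1+n) i≢n

    in-bounds : ∀ {T i} → i < size S T → ¬ Top (T , i) → i < size′ T
    in-bounds {T} {i} i< ¬top with T ≟ˢ C | T ≟ˢ A | T ≟ˢ B
    ... | yes refl | _ | _ = subst (i <_) (sym size′-C) (m<n⇒m<1+n i<)
    ... | no _ | yes refl | _ =
      subst (i <_) (sym size′-A) (below-top (subst (i <_) sizeA i<) (λ i≡a → ¬top (inj₁ (cong (A ,_) i≡a))))
    ... | no _ | no _ | yes refl =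
      subst (i <_) (sym size′-B) (below-top (subst (i <_) sizeB i<) (λ i≡b → ¬top (inj₂ (cong (B ,_) i≡b))))
    ... | no T≢C | no T≢A | no T≢B = subst (i <_) (sym (size′-rest T≢A T≢B T≢C)) i<

    old-slot : ∀ {T i} → i < size′ T → (T , i) ≢ new → i < size S T × ¬ Top (T , i)
    old-slot {T} {i} i< ≢new with T ≟ˢ C | T ≟ˢ A | T ≟ˢ B
    ... | yes refl | _ | _ =
      below-top (subst (i <_) size′-C i<) (λ i≡ → ≢new (cong (C ,_) i≡)) ,
      ¬Top (λ C≡A → A≢C (sym C≡A)) (λ C≡B → B≢C (sym C≡B))
    ... | no _ | yes refl | _ =
      subst (i <_) (sym sizeA) (m<n⇒m<1+n i<a) ,
      λ { (inj₁ eq) → <-irrefl (cong proj₂ eq) i<a ; (inj₂ eq) → A≢B (cong proj₁ eq) }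
      where
      i<a : i < a
      i<a = subst (i <_) size′-A i<
    ... | no _ | no _ | yes refl =
      subst (i <_) (sym sizeB) (m<n⇒m<1+n i<b) ,
      λ { (inj₁ eq) → A≢B (sym (cong proj₁ eq)) ; (inj₂ eq) → <-irrefl (cong proj₂ eq) i<b }
      where
      i<b : i < b
      i<b = subst (i <_) size′-B i<
    ... | no T≢C | no T≢A | no T≢B = subst (i <_) (size′-rest T≢A T≢B T≢C) i< , ¬Top T≢A T≢B

    not-new : ∀ x {j} → j ∈ˢ τ x → slot S x ≢ new
    not-new x j∈ slotx≡new = <-irrefl refl (subst (λ s → proj₂ s < size S (proj₁ s)) slotx≡new (slot< S x j∈))

    ∈-slotType : ∀ {x j s} → slot S x ≡ s → j ∈ˢ τ x → j ∈ˢ proj₁ s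
    ∈-slotType refl = type⊆ S _

    tops-unique : ∀ {x y j} → j ∈ˢ τ x → j ∈ˢ τ y → Top (slot S x) → Top (slot S y) → x ≡ y
    tops-unique j∈x j∈y (inj₁ p) (inj₁ q) = unique S j∈x j∈y (trans p (sym q))
    tops-unique j∈x j∈y (inj₂ p) (inj₂ q) = unique S j∈x j∈y (trans p (sym q))
    tops-unique j∈x j∈y (inj₁ p) (inj₂ q) = contradiction (∈-slotType q j∈y) (A∩B≡∅ (∈-slotType p j∈x))
    tops-unique j∈x j∈y (inj₂ p) (inj₁ q) = contradiction (∈-slotType p j∈x) (A∩B≡∅ (∈-slotType q j∈y))

    merged : Merging
    merged = record
      { size    = size′
      ; slot    = λ x → move (slot S x)
      ; type⊆   = type⊆′
      ; slot<   = slot<′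
      ; covered = covered′
      ; unique  = unique′
      }
      where
      InBounds : Slot → Set
      InBounds (T , i) = i < size′ T

      type⊆′ : ∀ x → τ x ⊆ proj₁ (move (slot S x))
      type⊆′ x with top? (slot S x)
      ... | yes top = subst (λ s → τ x ⊆ proj₁ s) (sym (move-top top)) (λ j∈ → Top⇒⊆C top (type⊆ S x j∈))
      ... | no ¬top = subst (λ s → τ x ⊆ proj₁ s) (sym (move-rest ¬top)) (type⊆ S x)

      slot<′ : ∀ x {j} → j ∈ˢ τ x → proj₂ (move (slot S x)) < size′ (proj₁ (move (slot S x)))
      slot<′ x j∈ with top? (slot S x)
      ... | yes top = subst InBounds (sym (move-top top)) (subst (size S C <_) (sym size′-C) (n<1+n _))
      ... | no ¬top = subst InBounds (sym (move-rest ¬top)) (in-bounds (slot< S x j∈) ¬top)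

      covered′ : ∀ {T i j} → i < size′ T → j ∈ˢ T → ∃ λ x → j ∈ˢ τ x × move (slot S x) ≡ (T , i)
      covered′ {T} {i} {j} i< j∈T with (T , i) ≟ₛ new
      ... | yes refl with x∈p∪q⁻ A B j∈T
      ...   | inj₁ j∈A with x , j∈x , slotx ← covered S (subst (a <_) (sym sizeA) (n<1+n a)) j∈A =
        x , j∈x , trans (cong move slotx) (move-top (inj₁ refl))
      ...   | inj₂ j∈B with x , j∈x , slotx ← covered S (subst (b <_) (sym sizeB) (n<1+n b)) j∈B =
        x , j∈x , trans (cong move slotx) (move-top (inj₂ refl))
      covered′ {T} {i} {j} i< j∈T | no ≢new with i<old , ¬top ← old-slot i< ≢new
        with x , j∈x , slotx ← covered S i<old j∈T =
        x , j∈x , trans (cong move slotx) (move-rest ¬top)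

      unique′ : ∀ {x y j} → j ∈ˢ τ x → j ∈ˢ τ y → move (slot S x) ≡ move (slot S y) → x ≡ y
      unique′ {x} {y} j∈x j∈y eq with top? (slot S x) | top? (slot S y)
      ... | yes tx | yes ty = tops-unique j∈x j∈y tx ty
      ... | yes tx | no ¬ty = contradiction (trans (sym (move-rest ¬ty)) (trans (sym eq) (move-top tx))) (not-new y j∈y)
      ... | no ¬tx | yes ty = contradiction (trans (sym (move-rest ¬tx)) (trans eq (move-top ty))) (not-new x j∈x)
      ... | no ¬tx | no ¬ty = unique S j∈x j∈y (trans (sym (move-rest ¬tx)) (trans eq (move-rest ¬ty)))

    merged-keeps-empty : ∀ {T} → T ≢ C → size S T ≡ 0 → size merged T ≡ 0
    merged-keeps-empty {T} T≢C empty with T ≟ˢ A | T ≟ˢ B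
    ... | yes refl | _ = contradiction (trans (sym sizeA) empty) λ ()
    ... | no _ | yes refl = contradiction (trans (sym sizeB) empty) λ ()
    ... | no T≢A | no T≢B = trans (size′-rest T≢A T≢B T≢C) empty

  module _ {A B : Subset d} (A∩B≡∅ : Disjoint A B) (A≢∅ : Nonempty A) (B≢∅ : Nonempty B) where

    private
      A≢B : A ≢ B
      A≢B refl = A∩B≡∅ (proj₂ A≢∅) (proj₂ A≢∅)

      A≢A∪B : A ≢ A ∪ B
      A≢A∪B A≡ = A∩B≡∅ (subst (_ ∈ˢ_) (sym A≡) (q⊆p∪q A B (proj₂ B≢∅))) (proj₂ B≢∅)

      B≢A∪B : B ≢ A ∪ B
      B≢A∪B B≡ = A∩B≡∅ (proj₂ A≢∅) (subst (_ ∈ˢ_) (sym B≡) (p⊆p∪q B (proj₂ A≢∅)))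

      module Top (S : Merging) = MergeTop S A∩B≡∅ A≢B A≢A∪B B≢A∪B

    mergeTops : ∀ a b (S : Merging) → size S A ≡ a → size S B ≡ b → Merging
    mergeTops (suc a) (suc b) S sizeA sizeB =
      mergeTops a b (Top.merged S sizeA sizeB) (Top.size′-A S sizeA sizeB) (Top.size′-B S sizeA sizeB)
    mergeTops zero    _       S _ _ = S
    mergeTops (suc a) zero    S _ _ = S

    mergeTops-exhausts : ∀ a b S (sizeA : size S A ≡ a) (sizeB : size S B ≡ b) →
                         let S′ = mergeTops a b S sizeA sizeB in size S′ A ≡ 0 ⊎ size S′ B ≡ 0
    mergeTops-exhausts (suc a) (suc b) S sizeA sizeB = mergeTops-exhausts a b _ _ _
    mergeTops-exhausts zero    _       S sizeA _     = inj₁ sizeA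
    mergeTops-exhausts (suc a) zero    S _     sizeB = inj₂ sizeB

    mergeTops-keeps-empty : ∀ {T} → T ≢ A ∪ B → ∀ a b S (sizeA : size S A ≡ a) (sizeB : size S B ≡ b) →
                            size S T ≡ 0 → size (mergeTops a b S sizeA sizeB) T ≡ 0
    mergeTops-keeps-empty T≢C (suc a) (suc b) S sizeA sizeB empty =
      mergeTops-keeps-empty T≢C a b _ _ _ (Top.merged-keeps-empty S sizeA sizeB T≢C empty)
    mergeTops-keeps-empty T≢C zero    _       S _ _ empty = empty
    mergeTops-keeps-empty T≢C (suc a) zero    S _ _ empty = empty

    merge : Merging → Merging
    merge S = mergeTops _ _ S refl refl

    merge-exhausts : ∀ S → size (merge S) A ≡ 0 ⊎ size (merge S) B ≡ 0
    merge-exhausts S = mergeTops-exhausts _ _ S refl refl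

    merge-keeps-empty : ∀ {T} → T ≢ A ∪ B → ∀ S → size S T ≡ 0 → size (merge S) T ≡ 0
    merge-keeps-empty T≢C S = mergeTops-keeps-empty T≢C _ _ S refl refl

resolveʳ : ∀ {A B : Set} → A ⊎ B → ¬ A → B
resolveʳ (inj₁ a) ¬a = contradiction a ¬a
resolveʳ (inj₂ b) _  = b

allButOne-of-pairwise : ∀ {P : Fin 3 → Set} → Decidable P →
                        P 0F ⊎ P 1F → P 0F ⊎ P 2F → P 1F ⊎ P 2F → ∃ λ o → ∀ j → j ≢ o → P j
allButOne-of-pairwise {P} P? p01 p02 p12 with P? 0F | P? 1F
... | yes p0 | yes p1 = 2F , λ { 0F _ → p0 ; 1F _ → p1 ; 2F 2≢2 → contradiction refl 2≢2 }
... | yes p0 | no ¬p1 = 1F , λ { 0F _ → p0 ; 1F 1≢1 → contradiction refl 1≢1 ; 2F _ → resolveʳ p12 ¬p1 }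
... | no ¬p0 | _     =
  0F , λ { 0F 0≢0 → contradiction refl 0≢0 ; 1F _ → resolveʳ p01 ¬p0 ; 2F _ → resolveʳ p02 ¬p0 }

module Settle {k} {τ : Fin k → Subset 3} where
  open Merge τ

  mergeSingletons : (i j : Fin 3) {i≢j : False (i ≟ j)} → Merging → Merging
  mergeSingletons i j {i≢j} = merge (⁅⁆-disjoint (toWitnessFalse i≢j)) (⁅⁆-nonempty i) (⁅⁆-nonempty j)

  completeSingleton : (i : Fin 3) → Nonempty (∁ ⁅ i ⁆) → Merging → Merging
  completeSingleton i ∁⁅i⁆≢∅ = merge ⁅⁆-∁-disjoint (⁅⁆-nonempty i) ∁⁅i⁆≢∅

  Empty : Merging → Subset 3 → Set
  Empty S T = size S T ≡ 0

  mergeSingletons-exhausts : ∀ i j {i≢j} S →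
    Empty (mergeSingletons i j {i≢j} S) ⁅ i ⁆ ⊎ Empty (mergeSingletons i j {i≢j} S) ⁅ j ⁆
  mergeSingletons-exhausts i j {i≢j} =
    merge-exhausts (⁅⁆-disjoint (toWitnessFalse i≢j)) (⁅⁆-nonempty i) (⁅⁆-nonempty j)

  mergeSingletons-keeps : ∀ i j {i≢j T} → T ≢ ⁅ i ⁆ ∪ ⁅ j ⁆ → ∀ S →
                          Empty S T → Empty (mergeSingletons i j {i≢j} S) T
  mergeSingletons-keeps i j {i≢j} =
    merge-keeps-empty (⁅⁆-disjoint (toWitnessFalse i≢j)) (⁅⁆-nonempty i) (⁅⁆-nonempty j)

  completeSingleton-exhausts : ∀ i ∁⁅i⁆≢∅ S →
    Empty (completeSingleton i ∁⁅i⁆≢∅ S) ⁅ i ⁆ ⊎ Empty (completeSingleton i ∁⁅i⁆≢∅ S) (∁ ⁅ i ⁆)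
  completeSingleton-exhausts i ∁⁅i⁆≢∅ = merge-exhausts ⁅⁆-∁-disjoint (⁅⁆-nonempty i) ∁⁅i⁆≢∅

  completeSingleton-keeps : ∀ i ∁⁅i⁆≢∅ {T} → T ≢ ⊤ → ∀ S →
                            Empty S T → Empty (completeSingleton i ∁⁅i⁆≢∅ S) T
  completeSingleton-keeps i ∁⁅i⁆≢∅ {T} T≢⊤ =
    merge-keeps-empty ⁅⁆-∁-disjoint (⁅⁆-nonempty i) ∁⁅i⁆≢∅ (λ T≡ → T≢⊤ (trans T≡ (p∪∁p≡⊤ ⁅ i ⁆)))

  record Settled (S : Merging) : Set where
    field
      odd : Fin 3
      singletons-empty : ∀ j → j ≢ odd → Empty S ⁅ j ⁆
      singleton-or-complement : ∀ j → Empty S ⁅ j ⁆ ⊎ Empty S (∁ ⁅ j ⁆)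

  module _ (S₀ : Merging) where

    -- No merge creates a singleton type, and ∁ ⁅ j ⁆ is only created right before the merge that
    -- settles j, so each emptiness established along the way persists until S₆.
    S₁ S₂ S₃ S₄ S₅ S₆ : Merging
    S₁ = mergeSingletons 0F 1F S₀
    S₂ = completeSingleton 2F (0F , here) S₁
    S₃ = mergeSingletons 0F 2F S₂
    S₄ = completeSingleton 1F (0F , here) S₃
    S₅ = mergeSingletons 1F 2F S₄
    S₆ = completeSingleton 0F (1F , there here) S₅

    private
      persists₅ : ∀ {T} → T ≢ ⊤ → Empty S₅ T → Empty S₆ T
      persists₅ ≢⊤ = completeSingleton-keeps 0F _ ≢⊤ S₅

      persists₄ : ∀ {T} → T ≢ ⊤ → T ≢ ∁ ⁅ 0F ⁆ → Empty S₄ T → Empty S₆ T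
      persists₄ ≢⊤ ≢∁0 = persists₅ ≢⊤ ∘ mergeSingletons-keeps 1F 2F ≢∁0 S₄

      persists₃ : ∀ {T} → T ≢ ⊤ → T ≢ ∁ ⁅ 0F ⁆ → Empty S₃ T → Empty S₆ T
      persists₃ ≢⊤ ≢∁0 = persists₄ ≢⊤ ≢∁0 ∘ completeSingleton-keeps 1F _ ≢⊤ S₃

      persists₂ : ∀ {T} → T ≢ ⊤ → T ≢ ∁ ⁅ 0F ⁆ → T ≢ ∁ ⁅ 1F ⁆ → Empty S₂ T → Empty S₆ T
      persists₂ ≢⊤ ≢∁0 ≢∁1 = persists₃ ≢⊤ ≢∁0 ∘ mergeSingletons-keeps 0F 2F ≢∁1 S₂

      persists₁ : ∀ {T} → T ≢ ⊤ → T ≢ ∁ ⁅ 0F ⁆ → T ≢ ∁ ⁅ 1F ⁆ → Empty S₁ T → Empty S₆ T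
      persists₁ ≢⊤ ≢∁0 ≢∁1 = persists₂ ≢⊤ ≢∁0 ≢∁1 ∘ completeSingleton-keeps 2F _ ≢⊤ S₁

    settled : Settled S₆
    settled = record
      { odd = proj₁ allButOne
      ; singletons-empty = proj₂ allButOne
      ; singleton-or-complement = λ
        { 0F → completeSingleton-exhausts 0F _ S₅
        ; 1F → Sum.map (persists₄ (λ ()) (λ ())) (persists₄ (λ ()) (λ ())) (completeSingleton-exhausts 1F _ S₃)
        ; 2F → Sum.map (persists₂ (λ ()) (λ ()) (λ ())) (persists₂ (λ ()) (λ ()) (λ ()))
                       (completeSingleton-exhausts 2F _ S₁)
        }
      }
      where
      allButOne : ∃ λ o → ∀ j → j ≢ o → Empty S₆ ⁅ j ⁆
      allButOne = allButOne-of-pairwise (λ j → size S₆ ⁅ j ⁆ ≟ℕ 0)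
        (Sum.map (persists₁ (λ ()) (λ ()) (λ ())) (persists₁ (λ ()) (λ ()) (λ ())) (mergeSingletons-exhausts 0F 1F S₀))
        (Sum.map (persists₃ (λ ()) (λ ())) (persists₃ (λ ()) (λ ())) (mergeSingletons-exhausts 0F 2F S₂))
        (Sum.map (persists₅ (λ ())) (persists₅ (λ ())) (mergeSingletons-exhausts 1F 2F S₄))

-- Three palettes give a decomposition

∈-tabulate⁺ : ∀ {d} {P : Pred (Fin d) 0ℓ} (P? : Decidable P) {j} → P j → j ∈ˢ tabulate (λ i → does (P? i))
∈-tabulate⁺ P? {j} pj = lookup⇒[]= j _ (trans (lookup∘tabulate _ j) (dec-true (P? j) pj))

∈-tabulate⁻ : ∀ {d} {P : Pred (Fin d) 0ℓ} (P? : Decidable P) {j} → j ∈ˢ tabulate (λ i → does (P? i)) → P j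
∈-tabulate⁻ P? {j} j∈ = does-true (P? j) (trans (sym (lookup∘tabulate _ j)) ([]=⇒lookup j∈))
  where
  does-true : ∀ {A : Set} (a? : Dec A) → does a? ≡ true → A
  does-true (yes a) _ = a

transpose-sends : ∀ {n} (i j : Fin n) → transpose i j ⟨$⟩ʳ i ≡ j
transpose-sends i j rewrite dec-true (i ≟ i) refl = refl

≢0F⇔ : ∀ (x : Fin 3) → x ≢ 0F ⇔ (x ≡ 1F ⊎ x ≡ 2F)
≢0F⇔ 0F = mk⇔ (λ x≢ → contradiction refl x≢) (λ { (inj₁ ()) ; (inj₂ ()) })
≢0F⇔ 1F = mk⇔ (λ _ → inj₁ refl) (λ _ ())
≢0F⇔ 2F = mk⇔ (λ _ → inj₂ refl) (λ _ ())

≢1F⇔ : ∀ (x : Fin 3) → x ≢ 1F ⇔ (x ≡ 0F ⊎ x ≡ 2F)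
≢1F⇔ 0F = mk⇔ (λ _ → inj₁ refl) (λ _ ())
≢1F⇔ 1F = mk⇔ (λ x≢ → contradiction refl x≢) (λ { (inj₁ ()) ; (inj₂ ()) })
≢1F⇔ 2F = mk⇔ (λ _ → inj₂ refl) (λ _ ())

≢2F⇔ : ∀ (x : Fin 3) → x ≢ 2F ⇔ (x ≡ 0F ⊎ x ≡ 1F)
≢2F⇔ 0F = mk⇔ (λ _ → inj₁ refl) (λ _ ())
≢2F⇔ 1F = mk⇔ (λ _ → inj₂ refl) (λ _ ())
≢2F⇔ 2F = mk⇔ (λ x≢ → contradiction refl x≢) (λ { (inj₁ ()) ; (inj₂ ()) })

∈∁⁅⁆⇔≢ : ∀ {d} {x y : Fin d} → x ∈ˢ ∁ ⁅ y ⁆ ⇔ x ≢ y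
∈∁⁅⁆⇔≢ = mk⇔ (λ x∈ x≡y → x∈∁p⇒x∉p x∈ (subst (_∈ˢ ⁅ _ ⁆) (sym x≡y) (x∈⁅x⁆ _)))
              (λ x≢y → x∉p⇒x∈∁p (x≢y ∘ x∈⁅y⁆⇒x≡y _))

module FromPalettes (G : Multigraph) {k} (c : Fin (Multigraph.m G) → Fin k) (proper : ProperColoring G c)
                    (f : Fin (Multigraph.n G) → Fin 3) (samePalette : ∀ v w → f v ≡ f w → SamePalette G c v w) where

  open Multigraph G

  inPalette? : ∀ v x → Dec (InPalette G c v x)
  inPalette? v x = any? (λ e → incident? G e v ×-dec (c e ≟ x))

  SeenByClass : Fin k → Fin 3 → Set
  SeenByClass x j = ∃ λ v → f v ≡ j × InPalette G c v x

  seenByClass? : ∀ x j → Dec (SeenByClass x j)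
  seenByClass? x j = any? (λ v → (f v ≟ j) ×-dec inPalette? v x)

  classes : Fin k → Subset 3
  classes x = tabulate (λ j → does (seenByClass? x j))

  classes⁺ : ∀ {v x} → InPalette G c v x → f v ∈ˢ classes x
  classes⁺ {v} {x} sees = ∈-tabulate⁺ (seenByClass? x) (v , refl , sees)

  classes⁻ : ∀ {v x} → f v ∈ˢ classes x → InPalette G c v x
  classes⁻ {v} {x} fv∈ with w , fw≡fv , w-sees ← ∈-tabulate⁻ (seenByClass? x) fv∈ =
    Equivalence.to (samePalette w v fw≡fv x) w-sees

  open Merge classes

  module _ (S : Merging) where

    edgeSlot : Fin m → Slot
    edgeSlot e = slot S (c e)

    edgeType : Fin m → Subset 3
    edgeType e = proj₁ (edgeSlot e)

    edgeIndex : Fin m → ℕ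
    edgeIndex e = proj₂ (edgeSlot e)

    edgeType∋ : ∀ {e v} → Incident G e v → f v ∈ˢ edgeType e
    edgeType∋ {e} e∋v = type⊆ S (c e) (classes⁺ (e , e∋v , refl))

    edgeIndex< : ∀ e → edgeIndex e < size S (edgeType e)
    edgeIndex< e = slot< S (c e) (classes⁺ (e , inj₁ refl , refl))

    module TypeSubgraph (a : Fin m → Fin 4) (V : Fin 4 → Subset n) (g : Fin 4) (T : Subset 3)
                        (a≡g⇔ : ∀ e → a e ≡ g ⇔ edgeType e ≡ T) (V≡ : ∀ v → v ∈ˢ V g ⇔ f v ∈ˢ T)
                        (e₀ : Fin m) (ae₀ : a e₀ ≡ g) where

      r : ℕ
      r = size S T

      index<r : ∀ {e} → a e ≡ g → edgeIndex e < r
      index<r {e} ae = subst (λ U → edgeIndex e < size S U) (Equivalence.to (a≡g⇔ e) ae) (edgeIndex< e)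

      instance
        r≢0 : NonZero r
        r≢0 = >-nonZero (m<n⇒0<n (index<r ae₀))

      -- mod only makes colour total: on the edges of the group the index is already below r.
      colour : Fin m → Fin r
      colour e = edgeIndex e mod r

      toℕ-colour : ∀ {e} → a e ≡ g → toℕ (colour e) ≡ edgeIndex e
      toℕ-colour ae = trans (toℕ-fromℕ< _) (m<n⇒m%n≡m (index<r ae))

      sameColour⇒sameSlot : ∀ {e e′} → a e ≡ g → a e′ ≡ g →
                            colour e ≡ colour e′ → edgeSlot e ≡ edgeSlot e′
      sameColour⇒sameSlot {e} {e′} ae ae′ eq =
        cong₂ _,_ (trans (Equivalence.to (a≡g⇔ e) ae) (sym (Equivalence.to (a≡g⇔ e′) ae′)))
                  (trans (sym (toℕ-colour ae)) (trans (cong toℕ eq) (toℕ-colour ae′)))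

      colour-proper : ProperOn G a g colour
      colour-proper e e′ ae ae′ adj@(_ , _ , e∋v , e′∋v) eq =
        proper e e′ adj (unique S (classes⁺ (e , e∋v , refl)) (classes⁺ (e′ , e′∋v , refl))
                                  (sameColour⇒sameSlot ae ae′ eq))

      module Seen {v} (fv∈T : f v ∈ˢ T) where

        seen : (s : Fin r) → ∃ λ e → Incident G e v × edgeSlot e ≡ (T , toℕ s)
        seen s with x , fv∈x , slotx ← covered S (toℕ<n s) fv∈T
               with e , e∋v , ce≡x ← classes⁻ fv∈x = e , e∋v , trans (cong (slot S) ce≡x) slotx

        seenEdge : Fin r → Fin m
        seenEdge s = proj₁ (seen s)

        seenEdge-slot : ∀ s → edgeSlot (seenEdge s) ≡ (T , toℕ s)
        seenEdge-slot s = proj₂ (proj₂ (seen s))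

        seenEdge-at : ∀ s → EdgeOfAt G a g v (seenEdge s)
        seenEdge-at s = Equivalence.from (a≡g⇔ _) (cong proj₁ (seenEdge-slot s)) , proj₁ (proj₂ (seen s))

        seenEdge-injective : ∀ {s s′} → seenEdge s ≡ seenEdge s′ → s ≡ s′
        seenEdge-injective {s} {s′} eq = toℕ-injective
          (trans (sym (cong proj₂ (seenEdge-slot s))) (trans (cong edgeIndex eq) (cong proj₂ (seenEdge-slot s′))))

      regular : IsRegularOf G a V g r
      regular v v∈V = ≤-antisym
        (Enumeration.injectiveOn⇒length≤ (edgeOfAt? G a g v) colour (properOn⇒injectiveAt G a g colour-proper v))
        (Enumeration.injection⇒≤length (edgeOfAt? G a g v) seenEdge seenEdge-at seenEdge-injective)
        where open Seen (Equivalence.to (V≡ v) v∈V)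

      subgraph : IsSubgraph G a V g
      subgraph e ae = endpoint (inj₁ refl) , endpoint (inj₂ refl)
        where
        endpoint : ∀ {u} → Incident G e u → u ∈ˢ V g
        endpoint {u} e∋u =
          Equivalence.from (V≡ u) (subst (f u ∈ˢ_) (Equivalence.to (a≡g⇔ e) ae) (edgeType∋ e∋u))

      class1 : Class1Regular G a V g
      class1 = subgraph , r , regular , colour , colour-proper

  module FromSettled (S : Merging) (settled : Settle.Settled S) where
    open Settle.Settled settled

    -- Sends the only class that may keep colours of singleton type to A₃.
    π : Permutation 3 3
    π = transpose odd 2F

    q : Fin 3 → Fin 3
    q = π ⟨$⟩ʳ_

    q-odd : q odd ≡ 2F
    q-odd = transpose-sends odd 2F

    q⁻¹ : Fin 3 → Fin 3
    q⁻¹ = π ⟨$⟩ˡ_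

    ≡q⁻¹⇔ : ∀ {x i} → x ≡ q⁻¹ i ⇔ q x ≡ i
    ≡q⁻¹⇔ = mk⇔ (λ { refl → inverseʳ π }) (λ { refl → sym (inverseˡ π) })

    opaque
      side : Fin 3 → Subset 3
      side j = if does (size S ⁅ j ⁆ ≟ℕ 0) then ∁ ⁅ j ⁆ else ⁅ j ⁆

      side-∁ : ∀ {j} → size S ⁅ j ⁆ ≡ 0 → side j ≡ ∁ ⁅ j ⁆
      side-∁ {j} empty rewrite dec-true (size S ⁅ j ⁆ ≟ℕ 0) empty = refl

      side-⁅⁆ : ∀ {j} → size S ⁅ j ⁆ ≢ 0 → side j ≡ ⁅ j ⁆
      side-⁅⁆ {j} nonempty rewrite dec-false (size S ⁅ j ⁆ ≟ℕ 0) nonempty = refl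

    groupType : Fin 4 → Subset 3
    groupType zero    = ⊤
    groupType (suc i) = side (q⁻¹ i)

    groupOf : Subset 3 → Fin 4
    groupOf (inside  ∷ inside  ∷ inside  ∷ []) = 0F
    groupOf (outside ∷ outside ∷ outside ∷ []) = 0F  -- junk: no edge has a colour of empty type
    groupOf (inside  ∷ outside ∷ outside ∷ []) = suc (q 0F)
    groupOf (outside ∷ inside  ∷ inside  ∷ []) = suc (q 0F)
    groupOf (outside ∷ inside  ∷ outside ∷ []) = suc (q 1F)
    groupOf (inside  ∷ outside ∷ inside  ∷ []) = suc (q 1F)
    groupOf (outside ∷ outside ∷ inside  ∷ []) = suc (q 2F)
    groupOf (inside  ∷ inside  ∷ outside ∷ []) = suc (q 2F)

    groupOf-⁅⁆ : ∀ j → groupOf ⁅ j ⁆ ≡ suc (q j)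
    groupOf-⁅⁆ 0F = refl
    groupOf-⁅⁆ 1F = refl
    groupOf-⁅⁆ 2F = refl

    groupOf-∁⁅⁆ : ∀ j → groupOf (∁ ⁅ j ⁆) ≡ suc (q j)
    groupOf-∁⁅⁆ 0F = refl
    groupOf-∁⁅⁆ 1F = refl
    groupOf-∁⁅⁆ 2F = refl

    groupOf-groupType : ∀ g → groupOf (groupType g) ≡ g
    groupOf-groupType zero    = refl
    groupOf-groupType (suc i) with size S ⁅ q⁻¹ i ⁆ ≟ℕ 0
    ... | yes empty = trans (cong groupOf (side-∁ empty)) (trans (groupOf-∁⁅⁆ _) (cong suc (inverseʳ π)))
    ... | no nonempty = trans (cong groupOf (side-⁅⁆ nonempty)) (trans (groupOf-⁅⁆ _) (cong suc (inverseʳ π)))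

    groupType-⁅⁆ : ∀ j → size S ⁅ j ⁆ ≢ 0 → groupType (suc (q j)) ≡ ⁅ j ⁆
    groupType-⁅⁆ j nonempty = trans (cong side (inverseˡ π)) (side-⁅⁆ nonempty)

    groupType-∁⁅⁆ : ∀ j → size S (∁ ⁅ j ⁆) ≢ 0 → groupType (suc (q j)) ≡ ∁ ⁅ j ⁆
    groupType-∁⁅⁆ j nonempty =
      trans (cong side (inverseˡ π)) (side-∁ (resolveʳ (Sum.swap (singleton-or-complement j)) nonempty))

    groupType-groupOf : ∀ T → Nonempty T → size S T ≢ 0 → groupType (groupOf T) ≡ T
    groupType-groupOf (inside  ∷ inside  ∷ inside  ∷ []) _ _ = refl
    groupType-groupOf (outside ∷ outside ∷ outside ∷ []) (_ , j∈⊥) _ = contradiction j∈⊥ ∉⊥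
    groupType-groupOf (inside  ∷ outside ∷ outside ∷ []) _ = groupType-⁅⁆ 0F
    groupType-groupOf (outside ∷ inside  ∷ inside  ∷ []) _ = groupType-∁⁅⁆ 0F
    groupType-groupOf (outside ∷ inside  ∷ outside ∷ []) _ = groupType-⁅⁆ 1F
    groupType-groupOf (inside  ∷ outside ∷ inside  ∷ []) _ = groupType-∁⁅⁆ 1F
    groupType-groupOf (outside ∷ outside ∷ inside  ∷ []) _ = groupType-⁅⁆ 2F
    groupType-groupOf (inside  ∷ inside  ∷ outside ∷ []) _ = groupType-∁⁅⁆ 2F

    a : Fin m → Fin 4
    a e = groupOf (edgeType S e)

    V : Fin 4 → Subset n
    V g = tabulate (λ v → does (f v ∈? groupType g))

    V≡ : ∀ g v → v ∈ˢ V g ⇔ f v ∈ˢ groupType g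
    V≡ g v = mk⇔ (∈-tabulate⁻ (λ v → f v ∈? groupType g)) (∈-tabulate⁺ (λ v → f v ∈? groupType g))

    a≡g⇔ : ∀ g e → a e ≡ g ⇔ edgeType S e ≡ groupType g
    a≡g⇔ g e = mk⇔
      (λ ae≡g → trans (sym (groupType-groupOf _ (_ , edgeType∋ S (inj₁ refl)) (m<n⇒n≢0 (edgeIndex< S e))))
                      (cong groupType ae≡g))
      (λ type≡ → trans (cong groupOf type≡) (groupOf-groupType g))

    class1 : ∀ g → Present G a g → Class1Regular G a V g
    class1 g (e₀ , ae₀) = TypeSubgraph.class1 S a V g (groupType g) (a≡g⇔ g) (V≡ g) e₀ ae₀

    p : Fin n → Fin 3
    p v = q (f v)

    V-complement : ∀ {i} → size S ⁅ q⁻¹ i ⁆ ≡ 0 → ∀ v → v ∈ˢ V (suc i) ⇔ p v ≢ i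
    V-complement {i} empty v = ⇔.trans (V≡ (suc i) v)
      (subst (λ U → f v ∈ˢ U ⇔ p v ≢ i) (sym (side-∁ empty))
        (⇔.trans ∈∁⁅⁆⇔≢ (mk⇔ (_∘ Equivalence.from ≡q⁻¹⇔) (_∘ Equivalence.to ≡q⁻¹⇔))))

    V-singleton : ∀ {i} → size S ⁅ q⁻¹ i ⁆ ≢ 0 → ∀ v → v ∈ˢ V (suc i) ⇔ p v ≡ i
    V-singleton {i} nonempty v = ⇔.trans (V≡ (suc i) v)
      (subst (λ U → f v ∈ˢ U ⇔ p v ≡ i) (sym (side-⁅⁆ nonempty)) (⇔.trans x∈⁅y⁆⇔x≡y ≡q⁻¹⇔))

    complementGroup : ∀ i → i ≢ 2F → ∀ v → v ∈ˢ V (suc i) ⇔ p v ≢ i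
    complementGroup i i≢2 = V-complement (singletons-empty _ q⁻¹i≢odd)
      where
      q⁻¹i≢odd : q⁻¹ i ≢ odd
      q⁻¹i≢odd eq = i≢2 (trans (sym (inverseʳ π)) (trans (cong q eq) q-odd))

    lastGroup : (∀ v → v ∈ˢ V 3F ⇔ p v ≡ 2F) ⊎ (∀ v → v ∈ˢ V 3F ⇔ p v ≢ 2F)
    lastGroup with size S ⁅ q⁻¹ 2F ⁆ ≟ℕ 0
    ... | yes empty    = inj₂ (V-complement empty)
    ... | no nonempty = inj₁ (V-singleton nonempty)

    decomposition : GoodDecomposition G
    decomposition =
      a , V , class1 , (λ _ v → Equivalence.from (V≡ 0F v) ∈⊤) , p ,
      (λ _ v → ⇔.trans (complementGroup 0F (λ ()) v) (≢0F⇔ (p v))) ,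
      (λ _ v → ⇔.trans (complementGroup 1F (λ ()) v) (≢1F⇔ (p v))) ,
      (λ _ → Sum.map₂ (λ V₃≡ v → ⇔.trans (V₃≡ v) (≢2F⇔ (p v))) lastGroup)

paletteIndex≤3⇒decomposition : ∀ G → PaletteIndex≤ G 3 → GoodDecomposition G
paletteIndex≤3⇒decomposition G (_ , c , proper , f , samePalette) =
  FromSettled.decomposition (Settle.S₆ separate) (Settle.settled separate)
  where
  open FromPalettes G c proper f samePalette
  open Merge classes

theorem7 : (G : Multigraph) → PaletteIndex≤ G 3 ⇔ GoodDecomposition G
theorem7 G = mk⇔ (paletteIndex≤3⇒decomposition G) (decomposition⇒paletteIndex≤3 G)
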